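{- For any $G\in\mathcal{G}$ (described below), every induced path $P$ in $G$ contains at most four $M$-components, where the $M$-components of $P$ are the connected components of the subgraph of $P$ induced by the vertices of $P$ lying in $M'$.
   Context: Let $M'$ be the fifth Mycielski graph $M_5$ (23 vertices $u_0,\dots,u_{22}$) with $u_{16}$ deleted and vertices renamed $v_0,\dots,v_{21}$; let $I=(t_0,t_1,t_2,t_3)=(v_1,v_3,v_{10},v_{21})$ and $I'=(t_0',t_1',t_2',t_3')=(v_{19},v_{17},v_{11},v_5)$, both independent, with $t_it_j'$ an edge iff $i\ne j$. Let $H$ be the graph on $a_0,b_0,a_1,b_1,a_2,c_0,c_1,c_2$ with edges $a_0b_0,b_0a_1,a_1b_1,b_1a_2,a_0c_0,a_1c_1,a_2c_2$ (vertices of $a$-, $b$-, $c$-type). For a Monotone Not-All-Equal-3-SAT instance $\phi$ with variables $x_0,\dots,x_n$ and clauses $S_0,\dots,S_m$, $G(\phi)$ consists of $M'$, an independent set of $x$-type vertices $x_0,\dots,x_n$ each adjacent to $t_2,t_3$, and for each clause $S_j=(x_{j_0},x_{j_1},x_{j_2})$ two copies $H_0,H_1$ of $H$ with $c_h$ adjacent to $x_{j_h}$. Every $x$-type vertex is adjacent to every $b$-type vertex; every $b$-type vertex to $t_0',t_1'$; every $c$-type vertex to $t_2',t_3'$; in $H_0$ copies add $a_0t_0,a_0t_2,a_1t_0,a_2t_0,a_2t_3$, in $H_1$ copies add $a_0t_1,a_0t_2,a_1t_1,a_2t_1,a_2t_3$. Thus $M'$ connects to the rest of $G(\phi)$ only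 through $I\cup I'$. $\mathcal{G}=\{G(\phi)\}$ over all instances $\phi$. -}

module Defs where

open import Data.Nat using (ℕ; zero; suc; _+_; _*_; _∸_; _<ᵇ_; _≡ᵇ_)
open import Data.Bool using (Bool; true; false; _∧_; _∨_; if_then_else_; T)
open import Data.Fin using (Fin; toℕ)
import Data.Fin as Fin
open import Data.List using (List; length; lookup)
open import Data.List.Relation.Unary.Unique.Propositional using (Unique)
open import Data.Product using (Σ; _×_)
open import Data.Sum using (_⊎_)
open import Data.Unit using (⊤)
open import Data.Empty using (⊥)
open import Relation.Nullary using (¬_; ⌊_⌋)
open import Relation.Binary.PropositionalEquality using (_≡_; _≢_)

-- Mycielskian of a graph on vertices 0..n-1 with adjacency A:
-- vertices 0..n-1 (originals v_i), n..2n-1 (copies u_i = n+i), 2n (apex w);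
-- v_i ~ v_j iff A i j;  u_i ~ v_j iff A i j;  w ~ u_i for all i.

mycielskian : ℕ → (ℕ → ℕ → Bool) → ℕ → ℕ → Bool
mycielskian n A i j =
  if (i <ᵇ n) ∧ (j <ᵇ n) then A i j
  else if (i <ᵇ n) ∧ (n <ᵇ suc j) ∧ (j <ᵇ n + n) then A i (j ∸ n)
  else if (n <ᵇ suc i) ∧ (i <ᵇ n + n) ∧ (j <ᵇ n) then A (i ∸ n) j
  else if (i ≡ᵇ n + n) ∧ (n <ᵇ suc j) ∧ (j <ᵇ n + n) then true
  else if (j ≡ᵇ n + n) ∧ (n <ᵇ suc i) ∧ (i <ᵇ n + n) then true
  else false

K2 : ℕ → ℕ → Bool
K2 0 1 = true
K2 1 0 = true
K2 _ _ = false

-- myc t = (number of vertices, adjacency) of M_{t+2}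
myc : ℕ → Σ ℕ (λ _ → ℕ → ℕ → Bool)
myc zero = 2 Data.Product., K2
myc (suc t) with myc t
... | n Data.Product., A = (n + n + 1) Data.Product., mycielskian n A

-- M_5 on vertices u_0 .. u_22
M5 : ℕ → ℕ → Bool
M5 = Data.Product.proj₂ (myc 3)

-- M' = M_5 - u_16, with v_i = u_i (i < 16), v_i = u_{i+1} (i ≥ 16)
rename : Fin 22 → ℕ
rename i = if toℕ i <ᵇ 16 then toℕ i else suc (toℕ i)

M'adj : Fin 22 → Fin 22 → Bool
M'adj i j = M5 (rename i) (rename j)

-- Monotone NAE-3-SAT instances: variables x_0..x_n, clauses S_0..S_m,
-- each clause a triple of pairwise distinct (positive) variables.

record Instance : Set where
  field
    n m    : ℕ
    clause : Fin (suc m) → Fin 3 → Fin (suc n)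
    distinct : ∀ j (h h' : Fin 3) → h ≢ h' → clause j h ≢ clause j h'
open Instance public

data HV : Set where
  a0 b0 a1 b1 a2 c0 c1 c2 : HV

Hedge : HV → HV → Bool
Hedge a0 b0 = true
Hedge b0 a1 = true
Hedge a1 b1 = true
Hedge b1 a2 = true
Hedge a0 c0 = true
Hedge a1 c1 = true
Hedge a2 c2 = true
Hedge _ _ = false

HVeq : HV → HV → Bool
HVeq a0 a0 = true
HVeq b0 b0 = true
HVeq a1 a1 = true
HVeq b1 b1 = true
HVeq a2 a2 = true
HVeq c0 c0 = true
HVeq c1 c1 = true
HVeq c2 c2 = true
HVeq _ _ = false

-- vertices of G(φ): M' vertices v_i, x-type vertices x_k,
-- and for clause j and copy h ∈ {0,1} the vertices of H_h
data V (φ : Instance) : Set where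
  mv : Fin 22 → V φ
  xv : Fin (suc (n φ)) → V φ
  hv : Fin (suc (m φ)) → Fin 2 → HV → V φ

-- named M' vertices: t0=v1 t1=v3 t2=v10 t3=v21, t0'=v19 t1'=v17 t2'=v11 t3'=v5
is : Fin 22 → ℕ → Bool
is i k = toℕ i ≡ᵇ k

cIndex : HV → Fin 3 → Bool
cIndex c0 h = toℕ h ≡ᵇ 0
cIndex c1 h = toℕ h ≡ᵇ 1
cIndex c2 h = toℕ h ≡ᵇ 2
cIndex _  _ = false

hToM : Fin 2 → HV → Fin 22 → Bool
hToM _ b0 i = is i 19 ∨ is i 17
hToM _ b1 i = is i 19 ∨ is i 17
hToM _ c0 i = is i 11 ∨ is i 5
hToM _ c1 i = is i 11 ∨ is i 5
hToM _ c2 i = is i 11 ∨ is i 5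
hToM Fin.zero a0 i = is i 1 ∨ is i 10
hToM Fin.zero a1 i = is i 1
hToM Fin.zero a2 i = is i 1 ∨ is i 21
hToM (Fin.suc _) a0 i = is i 3 ∨ is i 10
hToM (Fin.suc _) a1 i = is i 3
hToM (Fin.suc _) a2 i = is i 3 ∨ is i 21

isB : HV → Bool
isB b0 = true
isB b1 = true
isB _  = false

xToC : (φ : Instance) → Fin (suc (n φ)) → Fin (suc (m φ)) → HV → Bool
xToC φ k j c = (cIndex c Fin.zero ∧ ⌊ k Fin.≟ clause φ j Fin.zero ⌋)
             ∨ (cIndex c (Fin.suc Fin.zero) ∧ ⌊ k Fin.≟ clause φ j (Fin.suc Fin.zero) ⌋)
             ∨ (cIndex c (Fin.suc (Fin.suc Fin.zero)) ∧ ⌊ k Fin.≟ clause φ j (Fin.suc (Fin.suc Fin.zero)) ⌋)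

E : (φ : Instance) → V φ → V φ → Bool
E φ (mv i) (mv j) = M'adj i j
E φ (xv k) (mv i) = is i 10 ∨ is i 21
E φ (xv k) (hv j h c) = isB c ∨ xToC φ k j c
E φ (hv j h c) (mv i) = hToM h c i
E φ (hv j h c) (hv j' h' c') =
  ⌊ j Fin.≟ j' ⌋ ∧ ⌊ h Fin.≟ h' ⌋ ∧ Hedge c c'
E φ _ _ = false

Adj : (φ : Instance) → V φ → V φ → Set
Adj φ u v = T (E φ u v ∨ E φ v u)

IsInducedPath : (φ : Instance) → List (V φ) → Set
IsInducedPath φ ps =
  Unique ps ×
  (∀ (i j : Fin (length ps)) →
     (Adj φ (lookup ps i) (lookup ps j) → (toℕ i ∸ toℕ j ≡ 1 ⊎ toℕ j ∸ toℕ i ≡ 1)) ×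
     ((toℕ i ∸ toℕ j ≡ 1 ⊎ toℕ j ∸ toℕ i ≡ 1) → Adj φ (lookup ps i) (lookup ps j)))

inM : {φ : Instance} → V φ → Set
inM (mv _) = ⊤
inM (xv _) = ⊥
inM (hv _ _ _) = ⊥

data MConn {φ : Instance} (ps : List (V φ)) : Fin (length ps) → Fin (length ps) → Set where
  here : ∀ {i} → inM (lookup ps i) → MConn ps i i
  step : ∀ {i j k} → MConn ps i j → inM (lookup ps k) →
         Adj φ (lookup ps j) (lookup ps k) → MConn ps i k

AtMostFourMComponents : {φ : Instance} → List (V φ) → Set
AtMostFourMComponents ps =
  ¬ (Σ (Fin 5 → Fin (length ps)) λ f →
       (∀ a → inM (lookup ps (f a))) ×
       (∀ a b → a ≢ b → ¬ MConn ps (f a) (f b)))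

{-# OPTIONS --safe #-}
-- Every M-component C of an induced path P that is not all of P contains a vertex
-- next (on P) to a vertex outside M'; since M' meets the rest of G(φ) only in I ∪ I',
-- C contains a vertex of I ∪ I'. Vertices of I ∪ I' chosen in distinct components
-- are distinct and non-adjacent, for otherwise the components would merge. But
-- G[I ∪ I'] is the crown graph K₄,₄ minus a perfect matching, whose largest
-- independent sets have four vertices.
module Submission where

open import Defs
open import Data.Bool using (Bool; T; _∨_)
open import Data.Bool.Properties using (∨-comm)
open import Data.Empty using (⊥; ⊥-elim)
open import Data.Fin using (Fin; zero; suc; toℕ; _≟_; punchIn; #_)
open import Data.Fin.Properties using (all?; any?; pigeonhole; <⇒≢; punchInᵢ≢i)
open import Data.List using (List; []; _∷_; length; lookup)
open import Data.List.Membership.Propositional.Properties using (∈-lookup)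
open import Data.List.Relation.Unary.All as All using ()
open import Data.List.Relation.Unary.Linked using (Linked; []; [-]; _∷_)
open import Data.List.Relation.Unary.Unique.Propositional using (Unique; _∷_)
open import Data.Nat using (ℕ; _<_; _∸_; z<s; s<s)
open import Data.Nat.Properties using (n<1+n)
open import Data.Product using (∃; ∃₂; _×_; _,_; proj₁; proj₂)
open import Data.Sum using (_⊎_; inj₁; inj₂; [_,_]′; swap)
open import Data.Unit using (tt)
open import Data.Vec using ([]; _∷_)
import Data.Vec as Vec
open import Level using (Level)
open import Function using (_∘_; _on_; id)
open import Relation.Binary using (Rel; Symmetric)
open import Relation.Binary.Construct.Closure.ReflexiveTransitive using (Star; ε; _◅_; _◅◅_; gmap)
open import Relation.Binary.PropositionalEquality using (_≡_; _≢_; refl; sym; trans; cong; subst; subst₂)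
open import Relation.Nullary using (¬_; Dec; yes; no; T?; _⊎-dec_; _→-dec_; ¬?)
open import Relation.Nullary.Decidable using (True; toWitness; from-yes; map′)

private
  variable
    k l : ℕ
    ℓ : Level

CrownEdge : Rel (Fin k ⊎ Fin k) _
CrownEdge (inj₁ i) (inj₂ j) = i ≢ j
CrownEdge (inj₂ i) (inj₁ j) = i ≢ j
CrownEdge _        _        = ⊥

index : Fin k ⊎ Fin k → Fin k
index = [ id , id ]′

Independent : {A : Set} → Rel A _ → (Fin l → A) → Set
Independent _~_ f = ∀ {a b} → a ≢ b → f a ≢ f b × ¬ (f a ~ f b)

same-index⇒equal-or-swapped : (u v : Fin k ⊎ Fin k) → index u ≡ index v → u ≡ v ⊎ v ≡ swap u
same-index⇒equal-or-swapped (inj₁ i) (inj₁ .i) refl = inj₁ refl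
same-index⇒equal-or-swapped (inj₁ i) (inj₂ .i) refl = inj₂ refl
same-index⇒equal-or-swapped (inj₂ i) (inj₁ .i) refl = inj₂ refl
same-index⇒equal-or-swapped (inj₂ i) (inj₂ .i) refl = inj₁ refl

swapped-pair-dominates : (u w : Fin k ⊎ Fin k) → w ≢ u → w ≢ swap u →
                         CrownEdge u w ⊎ CrownEdge (swap u) w
swapped-pair-dominates (inj₁ i) (inj₁ j) w≢u _    = inj₂ (w≢u ∘ cong inj₁ ∘ sym)
swapped-pair-dominates (inj₁ i) (inj₂ j) _   w≢su = inj₁ (w≢su ∘ cong inj₂ ∘ sym)
swapped-pair-dominates (inj₂ i) (inj₁ j) _   w≢su = inj₁ (w≢su ∘ cong inj₁ ∘ sym)
swapped-pair-dominates (inj₂ i) (inj₂ j) w≢u _    = inj₂ (w≢u ∘ cong inj₂ ∘ sym)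

avoid-two : 2 < l → (a b : Fin l) → ∃ λ c → c ≢ a × c ≢ b
avoid-two (s<s (s<s (s<s _))) zero          zero          = suc zero , (λ ()) , (λ ())
avoid-two (s<s (s<s (s<s _))) zero          (suc zero)    = suc (suc zero) , (λ ()) , (λ ())
avoid-two (s<s (s<s (s<s _))) zero          (suc (suc _)) = suc zero , (λ ()) , (λ ())
avoid-two (s<s (s<s (s<s _))) (suc zero)    zero          = suc (suc zero) , (λ ()) , (λ ())
avoid-two (s<s (s<s (s<s _))) (suc (suc _)) zero          = suc zero , (λ ()) , (λ ())
avoid-two (s<s (s<s (s<s _))) (suc _)       (suc _)       = zero , (λ ()) , (λ ())

-- By pigeonhole two of the vertices form a matched pair {u, swap u}, and a third
-- vertex is adjacent to one of them.
crown-independent-bound : k < l → 2 < l → (f : Fin l → Fin k ⊎ Fin k) →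
                          ¬ Independent CrownEdge f
crown-independent-bound k<l 2<l f indep
  with a , b , a<b , same ← pigeonhole k<l (index ∘ f)
  with same-index⇒equal-or-swapped (f a) (f b) same
... | inj₁ fa≡fb = proj₁ (indep (<⇒≢ a<b)) fa≡fb
... | inj₂ fb≡sfa
  with c , c≢a , c≢b ← avoid-two 2<l a b
  with swapped-pair-dominates (f a) (f c) (proj₁ (indep c≢a))
         (subst (f c ≢_) fb≡sfa (proj₁ (indep c≢b)))
... | inj₁ fa~fc  = proj₂ (indep (c≢a ∘ sym)) fa~fc
... | inj₂ sfa~fc =
  proj₂ (indep (c≢b ∘ sym)) (subst (λ v → CrownEdge v (f c)) (sym fb≡sfa) sfa~fc)

lookup-injective : {A : Set} {xs : List A} → Unique xs →
                   ∀ i j → lookup xs i ≡ lookup xs j → i ≡ j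
lookup-injective (_ ∷ _)      zero    zero    _  = refl
lookup-injective (x∉xs ∷ _)   zero    (suc j) eq = ⊥-elim (All.lookup x∉xs (∈-lookup j) eq)
lookup-injective (x∉xs ∷ _)   (suc i) zero    eq = ⊥-elim (All.lookup x∉xs (∈-lookup i) (sym eq))
lookup-injective (_ ∷ unique) (suc i) (suc j) eq = cong suc (lookup-injective unique i j eq)

linked-from-consecutive : {A : Set} {R : Rel A ℓ} {xs : List A} →
  (∀ (i j : Fin (length xs)) → toℕ j ∸ toℕ i ≡ 1 → R (lookup xs i) (lookup xs j)) →
  Linked R xs
linked-from-consecutive {xs = []}         _      = []
linked-from-consecutive {xs = _ ∷ []}     _      = [-]
linked-from-consecutive {xs = _ ∷ _ ∷ _} R-next =
  R-next zero (suc zero) refl ∷ linked-from-consecutive (λ i j → R-next (suc i) (suc j))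

linked-connected : {A : Set} {R : Rel A ℓ} {xs : List A} → Symmetric R → Linked R xs →
                   ∀ i j → Star (R on lookup xs) i j
linked-connected R-sym [-]         zero    zero    = ε
linked-connected R-sym (Rxy ∷ Rys) zero    zero    = ε
linked-connected R-sym (Rxy ∷ Rys) zero    (suc j) =
  Rxy ◅ gmap suc id (linked-connected R-sym Rys zero j)
linked-connected R-sym (Rxy ∷ Rys) (suc i) zero    =
  gmap suc id (linked-connected R-sym Rys i zero) ◅◅ (R-sym Rxy ◅ ε)
linked-connected R-sym (Rxy ∷ Rys) (suc i) (suc j) =
  gmap suc id (linked-connected R-sym Rys i j)

t t′ : Fin 4 → Fin 22
t  = Vec.lookup (# 1 ∷ # 3 ∷ # 10 ∷ # 21 ∷ [])
t′ = Vec.lookup (# 19 ∷ # 17 ∷ # 11 ∷ # 5 ∷ [])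

terminal : Fin 4 ⊎ Fin 4 → Fin 22
terminal = [ t , t′ ]′

Terminal : Fin 22 → Set
Terminal i = ∃ λ x → terminal x ≡ i

terminal? : (i : Fin 22) → Dec (Terminal i)
terminal? i = map′ [ (λ (j , e) → inj₁ j , e) , (λ (j , e) → inj₂ j , e) ]′ split
                   (any? (λ j → t j ≟ i) ⊎-dec any? (λ j → t′ j ≟ i))
  where
  split : Terminal i → (∃ λ j → t j ≡ i) ⊎ (∃ λ j → t′ j ≡ i)
  split (inj₁ j , e) = inj₁ (j , e)
  split (inj₂ j , e) = inj₂ (j , e)

-- The implicit argument is solved by normalising the decision procedure, so this
-- only applies to concrete neighbourhoods, where it amounts to a finite check.
terminal-by-evaluation : (nbr : Fin 22 → Bool) →
                         {True (all? λ i → T? (nbr i) →-dec terminal? i)} →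
                         ∀ i → T (nbr i) → Terminal i
terminal-by-evaluation _ {check} = toWitness check

gadget-neighbour-terminal : ∀ h c i → T (hToM h c i) → Terminal i
gadget-neighbour-terminal zero    a0 = terminal-by-evaluation (hToM zero a0)
gadget-neighbour-terminal zero    a1 = terminal-by-evaluation (hToM zero a1)
gadget-neighbour-terminal zero    a2 = terminal-by-evaluation (hToM zero a2)
gadget-neighbour-terminal (suc h) a0 = terminal-by-evaluation (hToM (suc h) a0)
gadget-neighbour-terminal (suc h) a1 = terminal-by-evaluation (hToM (suc h) a1)
gadget-neighbour-terminal (suc h) a2 = terminal-by-evaluation (hToM (suc h) a2)
gadget-neighbour-terminal h       b0 = terminal-by-evaluation (hToM h b0)
gadget-neighbour-terminal h       b1 = terminal-by-evaluation (hToM h b1)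
gadget-neighbour-terminal h       c0 = terminal-by-evaluation (hToM h c0)
gadget-neighbour-terminal h       c1 = terminal-by-evaluation (hToM h c1)
gadget-neighbour-terminal h       c2 = terminal-by-evaluation (hToM h c2)

module _ {φ : Instance} where

  Adj-sym : Symmetric (Adj φ)
  Adj-sym {u} {v} = subst T (∨-comm (E φ u v) (E φ v u))

  outside-neighbour-terminal : ∀ i (v : V φ) → ¬ inM v → Adj φ (mv i) v → Terminal i
  outside-neighbour-terminal i (mv _)     v∉M = ⊥-elim (v∉M tt)
  outside-neighbour-terminal i (xv _)     _   = terminal-by-evaluation (λ j → is j 10 ∨ is j 21) i
  outside-neighbour-terminal i (hv _ h c) _   = gadget-neighbour-terminal h c i

  boundary-terminal : ∀ u v → inM u → ¬ inM v → Adj φ u v → ∃ λ x → u ≡ mv (terminal x)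
  boundary-terminal (mv i) v _ v∉M a =
    let x , x↦i = outside-neighbour-terminal i v v∉M a in x , cong mv (sym x↦i)

  crown-edges-adjacent : ∀ x y → CrownEdge x y → Adj φ (mv (terminal x)) (mv (terminal y))
  crown-edges-adjacent (inj₁ i) (inj₂ j) = t-t′-adjacent i j
    where
    t-t′-adjacent : ∀ i j → i ≢ j → T (M'adj (t i) (t′ j) ∨ M'adj (t′ j) (t i))
    t-t′-adjacent = from-yes (all? λ i → all? λ j →
                      ¬? (i ≟ j) →-dec T? (M'adj (t i) (t′ j) ∨ M'adj (t′ j) (t i)))
  crown-edges-adjacent (inj₂ i) (inj₁ j) i≢j =
    Adj-sym {mv (t j)} {mv (t′ i)} (crown-edges-adjacent (inj₁ j) (inj₂ i) (i≢j ∘ sym))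

  inM? : (v : V φ) → Dec (inM v)
  inM? (mv _)     = yes tt
  inM? (xv _)     = no λ ()
  inM? (hv _ _ _) = no λ ()

  module _ (ps : List (V φ)) where

    path-connected : IsInducedPath φ ps → ∀ i j → Star (Adj φ on lookup ps) i j
    path-connected (_ , adjacency) = linked-connected {xs = ps} (λ {u} {v} → Adj-sym {u} {v})
      (linked-from-consecutive {xs = ps} λ i j j∸i≡1 → proj₂ (adjacency i j) (inj₂ j∸i≡1))

    MConn-end : ∀ {i j} → MConn ps i j → inM (lookup ps j)
    MConn-end (here j∈M)     = j∈M
    MConn-end (step _ k∈M _) = k∈M

    MConn-trans : ∀ {i j k} → MConn ps i j → MConn ps j k → MConn ps i k
    MConn-trans i~j (here _)          = i~j
    MConn-trans i~j (step j~k l∈M kl) = step (MConn-trans i~j j~k) l∈M kl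

    MConn-sym : ∀ {i j} → MConn ps i j → MConn ps j i
    MConn-sym (here i∈M)        = here i∈M
    MConn-sym (step i~j k∈M jk) = MConn-trans (step (here k∈M) (MConn-end i~j) kj) (MConn-sym i~j)
      where kj = Adj-sym {lookup ps _} {lookup ps _} jk

    LeavesM : Fin (length ps) → Set
    LeavesM p = ∃₂ λ r s → MConn ps p r × ¬ inM (lookup ps s) × Adj φ (lookup ps r) (lookup ps s)

    walk : ∀ {p r q} → MConn ps p r → Star (Adj φ on lookup ps) r q → MConn ps p q ⊎ LeavesM p
    walk p~r ε = inj₁ p~r
    walk p~r (_◅_ {j = s} rs rest) with inM? (lookup ps s)
    ... | yes s∈M = walk (step p~r s∈M rs) rest
    ... | no  s∉M = inj₂ (_ , s , p~r , s∉M , rs)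

    ReachesTerminal : Fin (length ps) → Fin 4 ⊎ Fin 4 → Set
    ReachesTerminal p x = ∃ λ r → MConn ps p r × lookup ps r ≡ mv (terminal x)

    component-reaches-terminal : IsInducedPath φ ps → ∀ {p q} → inM (lookup ps p) →
                                 ¬ MConn ps p q → ∃ (ReachesTerminal p)
    component-reaches-terminal path {p} {q} p∈M p≁q
      with walk (here p∈M) (path-connected path p q)
    ... | inj₁ p~q = ⊥-elim (p≁q p~q)
    ... | inj₂ (r , s , p~r , s∉M , rs) =
      let x , r↦x = boundary-terminal (lookup ps r) (lookup ps s) (MConn-end p~r) s∉M rs
      in x , r , p~r , r↦x

    separated-terminals : Unique ps → ∀ {p q x y} → ReachesTerminal p x → ReachesTerminal q y →
                          ¬ MConn ps p q → x ≢ y × ¬ CrownEdge x y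
    separated-terminals unique {p} {q} {x} {y} (r , p~r , r↦x) (r′ , q~r′ , r′↦y) p≁q =
      different , non-adjacent
      where
      different : x ≢ y
      different refl =
        p≁q (MConn-trans p~r (subst (λ z → MConn ps z q) (sym r≡r′) (MConn-sym q~r′)))
        where
        r≡r′ : r ≡ r′
        r≡r′ = lookup-injective unique r r′ (trans r↦x (sym r′↦y))
      non-adjacent : ¬ CrownEdge x y
      non-adjacent x~y = p≁q (MConn-trans (step p~r (MConn-end q~r′) rr′) (MConn-sym q~r′))
        where
        rr′ : Adj φ (lookup ps r) (lookup ps r′)
        rr′ = subst₂ (Adj φ) (sym r↦x) (sym r′↦y) (crown-edges-adjacent x y x~y)

lemma3 : (φ : Instance) (ps : List (V φ)) →
         IsInducedPath φ ps → AtMostFourMComponents ps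
lemma3 φ ps path (f , f∈M , separated) =
  crown-independent-bound (n<1+n 4) (s<s (s<s z<s)) terminal-of independent
  where
  reach : ∀ a → ∃ (ReachesTerminal ps (f a))
  reach a = component-reaches-terminal ps path (f∈M a)
              (separated a (punchIn a zero) (punchInᵢ≢i a zero ∘ sym))
  terminal-of : Fin 5 → Fin 4 ⊎ Fin 4
  terminal-of a = proj₁ (reach a)
  independent : Independent CrownEdge terminal-of
  independent {a} {b} a≢b =
    separated-terminals ps (proj₁ path) (proj₂ (reach a)) (proj₂ (reach b)) (separated a b a≢b)
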